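{- Let $n$ and $a$ be integers such that $n$ is odd, $a$ is even and $2\leq a<n$. There exists a perfect matching $F$ of $K_{2n}$ such that $\ell(F)=\{1^a,n^{n-a}\}$.
   Context: For a positive integer $v$, $K_v$ denotes the complete graph on the vertex set $\{0,1,\ldots,v-1\}$. The length of an edge $\{u,w\}$ of $K_v$ is $\ell(u,w)=\min(|u-w|,\,v-|u-w|)$. For a subgraph $\Gamma$ of $K_v$, $\ell(\Gamma)$ is the list (multiset) of lengths of all edges of $\Gamma$, counted with multiplicity. A perfect matching of $K_{2n}$ is a set of $n$ pairwise disjoint edges covering all vertices. $\{1^a,n^b\}$ denotes the list with $a$ copies of $1$ and $b$ copies of $n$. -}

module Defs where

open import Data.Nat using (ℕ; _+_; _*_; _∸_; _<_; _≤_)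
open import Data.Nat.Base using (_⊓_)
open import Data.Product using (_×_; _,_)
open import Data.List using (List; []; _∷_; map; concatMap)
open import Data.List.Membership.Propositional using (_∈_)
open import Data.List.Relation.Unary.All using (All)
open import Data.List.Relation.Unary.Unique.Propositional using (Unique)
open import Relation.Binary.PropositionalEquality using (_≡_)
open import Relation.Nullary using (¬_)

-- An edge of K_v is represented as an (unordered) pair of vertices u , w.
Edge : Set
Edge = ℕ × ℕ

absDiff : ℕ → ℕ → ℕ
absDiff u w = (u ∸ w) + (w ∸ u)

edgeLength : ℕ → Edge → ℕ
edgeLength v (u , w) = absDiff u w ⊓ (v ∸ absDiff u w)

lengths : ℕ → List Edge → List ℕ
lengths v F = map (edgeLength v) F

endpoints : List Edge → List ℕ
endpoints [] = []
endpoints ((u , w) ∷ F) = u ∷ w ∷ endpoints F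

IsEdgeOf : ℕ → Edge → Set
IsEdgeOf v (u , w) = u < v × w < v × ¬ (u ≡ w)

-- a perfect matching of K_v: a set of edges of K_v, pairwise disjoint
-- (every vertex occurs at most once among all endpoints, which also makes
-- the edges distinct), covering every vertex of K_v.
IsPerfectMatching : ℕ → List Edge → Set
IsPerfectMatching v F =
  All (IsEdgeOf v) F ×
  Unique (endpoints F) ×
  (∀ x → x < v → x ∈ endpoints F)

-- Split the vertices of K_2n into a 2 × n grid: column c holds the vertices c and n + c.
-- A tiling of the n columns by dominoes and monominoes gives a perfect matching: a domino
-- on columns c, c + 1 contributes the two edges {c, c+1} and {n+c, n+c+1} of length 1, a
-- monomino on column c the edge {c, n+c} of length n.  Taking a/2 dominoes followed by
-- n − a monominoes yields the required list of lengths.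
module Submission where

open import Defs
open import Data.Nat using (ℕ; zero; suc; _+_; _*_; _∸_; _<_; _≤_; _⊓_; z≤n; s≤s)
open import Data.Nat.Divisibility using (_∣_; divides)
open import Data.Nat.Properties
open import Data.Product using (Σ; _×_; _,_)
open import Data.List using (List; []; _∷_; _++_; map; replicate; concatMap; applyUpTo; upTo)
open import Data.List.Properties using (map-++)
open import Data.Nat.ListAction using (sum)
open import Data.List.Membership.Propositional.Properties using (∈-upTo⁺)
open import Data.List.Relation.Unary.All using (All; []; _∷_)
open import Data.List.Relation.Unary.All.Properties using (all-upTo)
open import Data.List.Relation.Unary.AllPairs using (_∷_)
open import Data.List.Relation.Unary.Unique.Propositional using (Unique)
open import Data.List.Relation.Unary.Unique.Propositional.Properties using (upTo⁺)
open import Data.List.Relation.Binary.Permutation.Propositional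
  using (_↭_; ↭-refl; ↭-sym; ↭-reflexive; ↭⇒↭ₛ; module PermutationReasoning)
open import Data.List.Relation.Binary.Permutation.Propositional.Properties
  using (∈-resp-↭; All-resp-↭; ++⁺; ++⁺ˡ; ++-assoc; shifts)
open import Relation.Binary.PropositionalEquality
  using (_≡_; refl; sym; trans; cong; cong₂; subst; setoid; module ≡-Reasoning)
open import Data.List.Relation.Binary.Permutation.Setoid.Properties (setoid ℕ)
  using (Unique-resp-↭)
open import Relation.Nullary using (¬_)

absDiff-+ˡ : ∀ k u w → absDiff (k + u) (k + w) ≡ absDiff u w
absDiff-+ˡ k u w = cong₂ _+_ ([m+n]∸[m+o]≡n∸o k u w) ([m+n]∸[m+o]≡n∸o k w u)

absDiff-+ʳ : ∀ d u → absDiff u (d + u) ≡ d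
absDiff-+ʳ d u = cong₂ _+_ (m≤n⇒m∸n≡0 (m≤n+m u d)) (m+n∸n≡m d u)

edgeLength-translate : ∀ v k u w → edgeLength v (k + u , k + w) ≡ edgeLength v (u , w)
edgeLength-translate v k u w = cong (λ d → d ⊓ (v ∸ d)) (absDiff-+ˡ k u w)

edgeLength-+ : ∀ v d u → d + d ≤ v → edgeLength v (u , d + u) ≡ d
edgeLength-+ v d u d+d≤v rewrite absDiff-+ʳ d u = m≤n⇒m⊓n≡m (m+n≤o⇒m≤o∸n d d+d≤v)

range : ℕ → ℕ → List ℕ
range s zero    = []
range s (suc l) = s ∷ range (suc s) l

range-++ : ∀ s l m → range s l ++ range (l + s) m ≡ range s (l + m)
range-++ s zero    m = refl
range-++ s (suc l) m rewrite sym (+-suc l s) = cong (s ∷_) (range-++ (suc s) l m)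

map-+-range : ∀ k s l → map (k +_) (range s l) ≡ range (k + s) l
map-+-range k s zero    = refl
map-+-range k s (suc l) rewrite map-+-range k (suc s) l | +-suc k s = refl

upTo≡range : ∀ l → upTo l ≡ range 0 l
upTo≡range l = applyUpTo-shift (λ i → i) 0 l (λ _ → refl)
  where
  applyUpTo-shift : ∀ f s l → (∀ i → f i ≡ s + i) → applyUpTo f l ≡ range s l
  applyUpTo-shift f s zero    f≗ = refl
  applyUpTo-shift f s (suc l) f≗ =
    cong₂ _∷_ (trans (f≗ 0) (+-identityʳ s))
              (applyUpTo-shift (λ i → f (suc i)) (suc s) l (λ i → trans (f≗ (suc i)) (+-suc s i)))

endpoints-++ : ∀ F G → endpoints (F ++ G) ≡ endpoints F ++ endpoints G
endpoints-++ []            G = refl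
endpoints-++ ((u , w) ∷ F) G = cong (λ xs → u ∷ w ∷ xs) (endpoints-++ F G)

all-isEdgeOf : ∀ {v} F → Unique (endpoints F) → All (_< v) (endpoints F) → All (IsEdgeOf v) F
all-isEdgeOf []            _                      _                  = []
all-isEdgeOf ((u , w) ∷ F) ((u≢w ∷ _) ∷ _ ∷ uniq) (u<v ∷ w<v ∷ bnd) =
  (u<v , w<v , u≢w) ∷ all-isEdgeOf F uniq bnd

↭-upTo⇒isPerfectMatching : ∀ v F → endpoints F ↭ upTo v → IsPerfectMatching v F
↭-upTo⇒isPerfectMatching v F ends↭ =
  all-isEdgeOf F unique (All-resp-↭ (↭-sym ends↭) (all-upTo v)) ,
  unique ,
  λ x x<v → ∈-resp-↭ (↭-sym ends↭) (∈-upTo⁺ x<v)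
  where
  unique : Unique (endpoints F)
  unique = Unique-resp-↭ (↭⇒↭ₛ (↭-sym ends↭)) (upTo⁺ v)

data Tile : Set where
  domino monomino : Tile

width : Tile → ℕ
width domino   = 2
width monomino = 1

totalWidth : List Tile → ℕ
totalWidth T = sum (map width T)

totalWidth-dominoes : ∀ q T → totalWidth (replicate q domino ++ T) ≡ q * 2 + totalWidth T
totalWidth-dominoes zero    T = refl
totalWidth-dominoes (suc q) T = cong (λ w → suc (suc w)) (totalWidth-dominoes q T)

totalWidth-monominoes : ∀ m → totalWidth (replicate m monomino) ≡ m
totalWidth-monominoes zero    = refl
totalWidth-monominoes (suc m) = cong suc (totalWidth-monominoes m)

module Ladder (n : ℕ) where

  tileEdges : ℕ → Tile → List Edge
  tileEdges c domino   = (c , suc c) ∷ (n + c , n + suc c) ∷ []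
  tileEdges c monomino = (c , n + c) ∷ []

  tileLengths : Tile → List ℕ
  tileLengths domino   = 1 ∷ 1 ∷ []
  tileLengths monomino = n ∷ []

  place : ℕ → List Tile → List Edge
  place c []      = []
  place c (t ∷ T) = tileEdges c t ++ place (width t + c) T

  OnColumns : List ℕ → List Edge → Set
  OnColumns C F = endpoints F ↭ C ++ map (n +_) C

  OnColumns-++ : ∀ C D F G → OnColumns C F → OnColumns D G → OnColumns (C ++ D) (F ++ G)
  OnColumns-++ C D F G F↭ G↭ = begin
    endpoints (F ++ G)                   ≡⟨ endpoints-++ F G ⟩
    endpoints F ++ endpoints G           ↭⟨ ++⁺ F↭ G↭ ⟩
    (C ++ nC) ++ (D ++ nD)               ↭⟨ ++-assoc C nC (D ++ nD) ⟩
    C ++ (nC ++ D ++ nD)                 ↭⟨ ++⁺ˡ C (shifts nC D) ⟩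
    C ++ (D ++ nC ++ nD)                 ↭⟨ ++-assoc C D (nC ++ nD) ⟨
    (C ++ D) ++ (nC ++ nD)               ≡⟨ cong ((C ++ D) ++_) (map-++ (n +_) C D) ⟨
    (C ++ D) ++ map (n +_) (C ++ D)      ∎
    where
    open PermutationReasoning
    nC = map (n +_) C
    nD = map (n +_) D

  place-onColumns : ∀ c T → OnColumns (range c (totalWidth T)) (place c T)
  place-onColumns c []      = ↭-refl
  place-onColumns c (t ∷ T) =
    subst (λ C → OnColumns C (place c (t ∷ T))) (range-++ c (width t) (totalWidth T))
      (OnColumns-++ (range c (width t)) _ (tileEdges c t) _ (tile-onColumns t) (place-onColumns (width t + c) T))
    where
    tile-onColumns : ∀ t → OnColumns (range c (width t)) (tileEdges c t)
    tile-onColumns domino   = ↭-refl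
    tile-onColumns monomino = ↭-refl

  place-isPerfectMatching : ∀ T → totalWidth T ≡ n → IsPerfectMatching (2 * n) (place 0 T)
  place-isPerfectMatching T refl = ↭-upTo⇒isPerfectMatching (2 * n) (place 0 T) (begin
    endpoints (place 0 T)               ↭⟨ place-onColumns 0 T ⟩
    range 0 n ++ map (n +_) (range 0 n) ≡⟨ cong (range 0 n ++_) (map-+-range n 0 n) ⟩
    range 0 n ++ range (n + 0) n        ≡⟨ range-++ 0 n n ⟩
    range 0 (n + n)                     ≡⟨ cong (λ m → range 0 (n + m)) (+-identityʳ n) ⟨
    range 0 (2 * n)                     ≡⟨ upTo≡range (2 * n) ⟨
    upTo (2 * n)                        ∎)
    where open PermutationReasoning

  lengths-place : 1 ≤ n → ∀ c T → lengths (2 * n) (place c T) ≡ concatMap tileLengths T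
  lengths-place 1≤n c []      = refl
  lengths-place 1≤n c (t ∷ T) =
    trans (map-++ (edgeLength (2 * n)) (tileEdges c t) (place (width t + c) T))
          (cong₂ _++_ (lengths-tile t) (lengths-place 1≤n (width t + c) T))
    where
    unitEdge : ∀ u → edgeLength (2 * n) (u , suc u) ≡ 1
    unitEdge u = edgeLength-+ (2 * n) 1 u (*-monoʳ-≤ 2 1≤n)
    lengths-tile : ∀ t → lengths (2 * n) (tileEdges c t) ≡ tileLengths t
    lengths-tile domino   =
      cong₂ _∷_ (unitEdge c) (cong (_∷ []) (trans (edgeLength-translate (2 * n) n c (suc c)) (unitEdge c)))
    lengths-tile monomino =
      cong (_∷ []) (edgeLength-+ (2 * n) n c (≤-reflexive (cong (n +_) (sym (+-identityʳ n)))))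

  tileLengths-dominoes-monominoes : ∀ q m →
    concatMap tileLengths (replicate q domino ++ replicate m monomino) ≡ replicate (q * 2) 1 ++ replicate m n
  tileLengths-dominoes-monominoes zero    zero    = refl
  tileLengths-dominoes-monominoes zero    (suc m) = cong (n ∷_) (tileLengths-dominoes-monominoes zero m)
  tileLengths-dominoes-monominoes (suc q) m       = cong (λ xs → 1 ∷ 1 ∷ xs) (tileLengths-dominoes-monominoes q m)

lemma3p7 : (n a : ℕ) → ¬ (2 ∣ n) → 2 ∣ a → 2 ≤ a → a < n →
    Σ (List Edge) (λ F → IsPerfectMatching (2 * n) F ×
    (lengths (2 * n) F ↭ (replicate a 1 ++ replicate (n ∸ a) n)))
lemma3p7 n a _ (divides q refl) _ a<n =
  place 0 T , place-isPerfectMatching T width≡n ,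
  ↭-reflexive (trans (lengths-place (≤-trans (s≤s z≤n) a<n) 0 T) (tileLengths-dominoes-monominoes q m))
  where
  open Ladder n
  m : ℕ
  m = n ∸ q * 2
  T : List Tile
  T = replicate q domino ++ replicate m monomino
  width≡n : totalWidth T ≡ n
  width≡n = begin
    totalWidth T                              ≡⟨ totalWidth-dominoes q (replicate m monomino) ⟩
    q * 2 + totalWidth (replicate m monomino) ≡⟨ cong (q * 2 +_) (totalWidth-monominoes m) ⟩
    q * 2 + m                                 ≡⟨ m+[n∸m]≡n (<⇒≤ a<n) ⟩
    n                                         ∎
    where open ≡-Reasoning
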